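{- For all non-bipartite graphs $\mathcal{G}$, $V^0$ proves that there is no homomorphism from $\mathcal{G}$ to $\mathcal{K}_2$: $$V^0\vdash\forall\mathcal{G}\,\big(NONBIP(\mathcal{G})\to\neg HOM(\mathcal{G},\mathcal{K}_2)\big).$$
   Context: $V^0$ is the two-sorted first-order theory over the vocabulary $\mathcal{L}^2_{PA}=\{0,1,+,\cdot,|\cdot|;=_1,=_2,\leq,\in\}$, with number variables (ranging over $\mathbb{N}$) and string (finite set) variables ranging over finite subsets of $\mathbb{N}$; $|X|$ denotes the least upper bound of $X$ and $X(t)$ abbreviates $t\in X$. $V^0$ is axiomatized by the standard basic axioms 2-BASIC and the comprehension scheme $\Sigma^B_0$-COMP: $\exists X\leq y\,\forall z<y\,(X(z)\leftrightarrow\varphi(z))$ for every formula $\varphi$ whose only quantifiers are bounded number quantifiers. A bounded string quantifier $\exists X\leq t$ means $\exists X(|X|\leq t\wedge\dots)$. Divisibility: $x|y\leftrightarrow\exists z\leq y\,(x\cdot z=y)$. The pairing function is $\langle x,y\rangle=(x+y)(x+y+1)+2y$, and $E(i,j)$ abbreviates $E(\langle i,j\rangle)$. A graph is a pair of strings $\mathcal{G}=(V_\mathcal{G},E_\mathcal{G})$ with $|V_\mathcal{G}|=n$ satisfying $\forall i<n\,V_\mathcal{G}(i)\wedge\forall i<j<n\,(E_\mathcal{G}(i,j)\leftrightarrow E_\mathcal{G}(j,i))\wedge\forall i<n\,\neg E_\mathcal{G}(i,i)$; quantification over graphs is over such pairs. $\mathcal{K}_2$ is the complete graph on the two vertices $0,1$.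 $MAP(n,m,Z):\ \forall i<n\,\exists j<m\,Z(\langle i,j\rangle)\wedge\forall i<n\,\forall j_1,j_2<m\,(Z(\langle i,j_1\rangle)\wedge Z(\langle i,j_2\rangle)\to j_1=j_2)$. For graphs with $|V_\mathcal{G}|=n$, $|V_\mathcal{H}|=m$: $HOM(\mathcal{G},\mathcal{H}):\ \exists Z\leq\langle n-1,m-1\rangle\,\big(MAP(n,m,Z)\wedge\forall i_1,i_2<n\,\forall j_1,j_2<m\,(E_\mathcal{G}(i_1,i_2)\wedge Z(\langle i_1,j_1\rangle)\wedge Z(\langle i_2,j_2\rangle)\to E_\mathcal{H}(j_1,j_2))\big)$. For a pair $\mathcal{C}_k=(V_{\mathcal{C}_k},E_{\mathcal{C}_k})$ with $|V_{\mathcal{C}_k}|=k$: $CYCLE(\mathcal{C}_k):\ E_{\mathcal{C}_k}(0,k-1)\wedge\forall i<k-1\,E_{\mathcal{C}_k}(i,i+1)\wedge\forall i,j<k-1\,(j\neq i+1\to\neg E_{\mathcal{C}_k}(i,j))$. For a graph $\mathcal{G}$ with $|V_\mathcal{G}|=n$: $NONBIP(\mathcal{G}):\ \exists k\leq n\,\big(2|(k-1)\wedge\exists V_{\mathcal{C}_k}\,(|V_{\mathcal{C}_k}|=k)\,\exists E_{\mathcal{C}_k}\,(|E_{\mathcal{C}_k}|<4k^2)\,(CYCLE(V_{\mathcal{C}_k},E_{\mathcal{C}_k})\wedge HOM(\mathcal{C}_k,\mathcal{G}))\big)$. -}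

module Defs where

open import Data.Nat using (ℕ; suc)
open import Data.Fin using (Fin; zero; suc)
open import Data.Product using (Σ; _×_; _,_)
open import Data.Sum using (_⊎_)
open import Relation.Nullary using (¬_)
open import Relation.Binary.PropositionalEquality using (_≡_; _≢_)

-- Two-sorted structures for the vocabulary L²_PA
--   {0,1,+,·,|·| ; =₁,=₂,≤,∈}
-- Equality of both sorts is interpreted as real (propositional)
-- equality (normal models).

record Structure : Set₁ where
  field
    Num  : Set
    Str  : Set
    z0   : Num
    z1   : Num
    add  : Num → Num → Num
    mul  : Num → Num → Num
    len  : Str → Num
    leq  : Num → Num → Set
    mem  : Num → Str → Set

-- Syntax of Σ^B_0 formulas (de Bruijn: n number variables, s string
-- variables).  Only bounded number quantifiers, no string quantifiers.

data Tm (n s : ℕ) : Set where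
  var  : Fin n → Tm n s
  `0   : Tm n s
  `1   : Tm n s
  _`+_ : Tm n s → Tm n s → Tm n s
  _`*_ : Tm n s → Tm n s → Tm n s
  `len : Fin s → Tm n s

data Fm (n s : ℕ) : Set where
  _`=_  : Tm n s → Tm n s → Fm n s
  _`≤_  : Tm n s → Tm n s → Fm n s
  _`∈_  : Tm n s → Fin s → Fm n s
  _`=₂_ : Fin s → Fin s → Fm n s
  `¬    : Fm n s → Fm n s
  _`∧_  : Fm n s → Fm n s → Fm n s
  _`∨_  : Fm n s → Fm n s → Fm n s
  _`⇒_  : Fm n s → Fm n s → Fm n s
  `∀≤   : Tm n s → Fm (suc n) s → Fm n s    -- ∀x ≤ t φ  (x = var zero)
  `∃≤   : Tm n s → Fm (suc n) s → Fm n s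

module Sem (M : Structure) where
  open Structure M

  _↔_ : Set → Set → Set
  A ↔ B = (A → B) × (B → A)

  extend : ∀ {n} → (Fin n → Num) → Num → Fin (suc n) → Num
  extend ρ x zero    = x
  extend ρ x (suc i) = ρ i

  ⟦_⟧t : ∀ {n s} → Tm n s → (Fin n → Num) → (Fin s → Str) → Num
  ⟦ var i ⟧t ρ σ    = ρ i
  ⟦ `0 ⟧t ρ σ       = z0
  ⟦ `1 ⟧t ρ σ       = z1
  ⟦ t `+ u ⟧t ρ σ   = add (⟦ t ⟧t ρ σ) (⟦ u ⟧t ρ σ)
  ⟦ t `* u ⟧t ρ σ   = mul (⟦ t ⟧t ρ σ) (⟦ u ⟧t ρ σ)
  ⟦ `len X ⟧t ρ σ   = len (σ X)

  ⟦_⟧f : ∀ {n s} → Fm n s → (Fin n → Num) → (Fin s → Str) → Set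
  ⟦ t `= u ⟧f ρ σ   = ⟦ t ⟧t ρ σ ≡ ⟦ u ⟧t ρ σ
  ⟦ t `≤ u ⟧f ρ σ   = leq (⟦ t ⟧t ρ σ) (⟦ u ⟧t ρ σ)
  ⟦ t `∈ X ⟧f ρ σ   = mem (⟦ t ⟧t ρ σ) (σ X)
  ⟦ X `=₂ Y ⟧f ρ σ  = σ X ≡ σ Y
  ⟦ `¬ φ ⟧f ρ σ     = ¬ ⟦ φ ⟧f ρ σ
  ⟦ φ `∧ ψ ⟧f ρ σ   = ⟦ φ ⟧f ρ σ × ⟦ ψ ⟧f ρ σ
  ⟦ φ `∨ ψ ⟧f ρ σ   = ⟦ φ ⟧f ρ σ ⊎ ⟦ ψ ⟧f ρ σ
  ⟦ φ `⇒ ψ ⟧f ρ σ   = ⟦ φ ⟧f ρ σ → ⟦ ψ ⟧f ρ σ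
  ⟦ `∀≤ t φ ⟧f ρ σ  = (x : Num) → leq x (⟦ t ⟧t ρ σ) → ⟦ φ ⟧f (extend ρ x) σ
  ⟦ `∃≤ t φ ⟧f ρ σ  = Σ Num λ x → leq x (⟦ t ⟧t ρ σ) × ⟦ φ ⟧f (extend ρ x) σ

  _<_ : Num → Num → Set
  x < y = leq x y × x ≢ y

  two four : Num
  two  = add z1 z1
  four = add two two

  pair : Num → Num → Num
  pair x y = add (mul (add x y) (add (add x y) z1)) (mul two y)

  Ed : Str → Num → Num → Set
  Ed E i j = mem (pair i j) E

  Divides : Num → Num → Set
  Divides x y = Σ Num λ z → leq z y × mul x z ≡ y

  -- IsPred k p :  p = k - 1  (truncated subtraction: 0 - 1 = 0)
  IsPred : Num → Num → Set
  IsPred k p = (add p z1 ≡ k) ⊎ (k ≡ z0 × p ≡ z0)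

  IsGraph : Str → Str → Set
  IsGraph V E =
      ((i : Num) → i < len V → mem i V)
    × ((i j : Num) → i < j → j < len V → Ed E i j ↔ Ed E j i)
    × ((i : Num) → i < len V → ¬ Ed E i i)

  MAP : Num → Num → Str → Set
  MAP n m Z =
      ((i : Num) → i < n → Σ Num λ j → j < m × mem (pair i j) Z)
    × ((i j₁ j₂ : Num) → i < n → j₁ < m → j₂ < m →
         mem (pair i j₁) Z → mem (pair i j₂) Z → j₁ ≡ j₂)

  HOM : Num → Str → Num → Str → Set
  HOM n EG m EH =
    Σ Num λ n₁ → Σ Num λ m₁ → IsPred n n₁ × IsPred m m₁ ×
    (Σ Str λ Z → leq (len Z) (pair n₁ m₁) × MAP n m Z ×
      ((i₁ i₂ j₁ j₂ : Num) → i₁ < n → i₂ < n → j₁ < m → j₂ < m →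
         Ed EG i₁ i₂ → mem (pair i₁ j₁) Z → mem (pair i₂ j₂) Z →
         Ed EH j₁ j₂))

  CYCLE : Num → Str → Set
  CYCLE k E =
    Σ Num λ k₁ → IsPred k k₁ ×
      Ed E z0 k₁
    × ((i : Num) → i < k₁ → Ed E i (add i z1))
    × ((i j : Num) → i < k₁ → j < k₁ → j ≢ add i z1 → ¬ Ed E i j)

  NONBIP : Str → Str → Set
  NONBIP V E =
    Σ Num λ k → leq k (len V) ×
      (Σ Num λ k₁ → IsPred k k₁ × Divides two k₁) ×
      (Σ Str λ VC → len VC ≡ k ×
        (Σ Str λ EC → len EC < mul four (mul k k) ×
          CYCLE k EC × HOM k EC (len V) E))

  IsK2 : Str → Str → Set
  IsK2 VK EK =
      len VK ≡ two
    × ((x : Num) → mem x VK ↔ (x ≡ z0 ⊎ x ≡ z1))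
    × ((x : Num) → mem x EK ↔ (x ≡ pair z0 z1 ⊎ x ≡ pair z1 z0))

-- Models of V⁰ = 2-BASIC + Σ^B_0-COMP

record IsV0Model (M : Structure) : Set where
  open Structure M
  open Sem M
  field
    B1  : ∀ x → add x z1 ≢ z0
    B2  : ∀ x y → add x z1 ≡ add y z1 → x ≡ y
    B3  : ∀ x → add x z0 ≡ x
    B4  : ∀ x y → add x (add y z1) ≡ add (add x y) z1
    B5  : ∀ x → mul x z0 ≡ z0
    B6  : ∀ x y → mul x (add y z1) ≡ add (mul x y) x
    B7  : ∀ x y → leq x y → leq y x → x ≡ y
    B8  : ∀ x y → leq x (add x y)
    B9  : ∀ x → leq z0 x
    B10 : ∀ x y → leq x y ⊎ leq y x
    B11 : ∀ x y → leq x y ↔ (x < add y z1)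
    B12 : ∀ x → x ≢ z0 → Σ Num λ y → leq y x × add y z1 ≡ x
    L1  : ∀ (X : Str) y → mem y X → y < len X
    L2  : ∀ (X : Str) y → add y z1 ≡ len X → mem y X
    SE  : ∀ (X Y : Str) → len X ≡ len Y →
            ((i : Num) → i < len X → mem i X ↔ mem i Y) → X ≡ Y
    COMP : ∀ {n s} (φ : Fm (suc n) s) (ρ : Fin n → Num) (σ : Fin s → Str)
             (y : Num) →
             Σ Str λ X → leq (len X) y ×
               ((z : Num) → z < y → mem z X ↔ ⟦ φ ⟧f (extend ρ z) σ)

module Submission where

open import Defs
open import Level using (0ℓ)
open import Axiom.ExcludedMiddle using (ExcludedMiddle)
open import Relation.Nullary using (¬_; Dec; yes; no; contradiction)
open import Data.Nat as ℕ using (ℕ; zero; suc)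
open import Data.Nat.Properties using (+-identityʳ; +-suc; +-comm; *-zeroʳ; *-suc)
open import Data.Fin using (zero; suc)
open import Data.Vec.Functional using ([]; _∷_)
open import Data.Product using (Σ; _×_; _,_; proj₁; proj₂)
open import Data.Sum using (_⊎_; inj₁; inj₂)
open import Data.Empty using (⊥; ⊥-elim)
open import Relation.Binary.PropositionalEquality
  using (_≡_; _≢_; refl; sym; trans; cong; cong₂; subst; module ≡-Reasoning)

-- Composing the homomorphism C₂ₜ₊₁ → G given by NONBIP(G) with a homomorphism G → K₂ colours the
-- cycle's vertices 0, …, 2t by 0 and 1 so that adjacent vertices get different colours; hence
-- vertices i and i + 2 get the same colour. The colouring is Σᴮ₀-definable from the strings of the
-- two homomorphisms, so Σᴮ₀-induction on s shows that every vertex 2s ≤ 2t has the colour of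
-- vertex 0 — yet vertex 2t is adjacent to vertex 0. Σᴮ₀-induction follows from Σᴮ₀-COMP; excluded
-- middle supplies the case distinctions (x = y or not) that the order axioms of 2-BASIC need.

⟨_,_⟩ᵗ : ∀ {n s} → Tm n s → Tm n s → Tm n s
⟨ x , y ⟩ᵗ = ((x `+ y) `* ((x `+ y) `+ `1)) `+ ((`1 `+ `1) `* y)

⟦_⟧ℕ : Tm 0 0 → ℕ
⟦ `0 ⟧ℕ     = 0
⟦ `1 ⟧ℕ     = 1
⟦ t `+ u ⟧ℕ = ⟦ t ⟧ℕ ℕ.+ ⟦ u ⟧ℕ
⟦ t `* u ⟧ℕ = ⟦ t ⟧ℕ ℕ.* ⟦ u ⟧ℕ

two-valued-alternation : ∀ {A : Set} {a b x y z : A} →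
  x ≡ a ⊎ x ≡ b → y ≡ a ⊎ y ≡ b → z ≡ a ⊎ z ≡ b → x ≢ y → y ≢ z → z ≡ x
two-valued-alternation (inj₁ refl) (inj₁ refl) _ x≢y _ = ⊥-elim (x≢y refl)
two-valued-alternation (inj₂ refl) (inj₂ refl) _ x≢y _ = ⊥-elim (x≢y refl)
two-valued-alternation _ (inj₁ refl) (inj₁ refl) _ y≢z = ⊥-elim (y≢z refl)
two-valued-alternation _ (inj₂ refl) (inj₂ refl) _ y≢z = ⊥-elim (y≢z refl)
two-valued-alternation (inj₁ refl) (inj₂ refl) (inj₁ refl) _ _ = refl
two-valued-alternation (inj₂ refl) (inj₁ refl) (inj₂ refl) _ _ = refl

module V⁰ (em : ExcludedMiddle 0ℓ) (M : Structure) (model : IsV0Model M) where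
  open Structure M
  open Sem M
  open IsV0Model model

  variable
    c c₁ c₂ i₁ i₂ k l m n p x y : Num
    EG EH EK VK X Z₁ Z₂ : Str

  S : Num → Num
  S x = add x z1

  _≟_ : (x y : Num) → Dec (x ≡ y)
  x ≟ y = em

  ≤-refl : ∀ x → leq x x
  ≤-refl x = subst (leq x) (B3 x) (B8 x z0)

  <-irrefl : ¬ x < x
  <-irrefl (_ , x≢x) = x≢x refl

  ≤⇒<S : leq x y → x < S y
  ≤⇒<S = proj₁ (B11 _ _)

  <S⇒≤ : x < S y → leq x y
  <S⇒≤ = proj₂ (B11 _ _)

  n≤0⇒n≡0 : leq x z0 → x ≡ z0
  n≤0⇒n≡0 {x} x≤0 = B7 x z0 x≤0 (B9 x)

  n≮0 : ¬ x < z0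
  n≮0 (x≤0 , x≢0) = x≢0 (n≤0⇒n≡0 x≤0)

  Sx≰x : ¬ leq (S x) x
  Sx≰x {x} Sx≤x = <-irrefl (subst (x <_) (sym (B7 x (S x) (B8 x z1) Sx≤x)) (≤⇒<S (≤-refl x)))

  ≤S⇒≤⊎≡S : leq x (S y) → leq x y ⊎ x ≡ S y
  ≤S⇒≤⊎≡S {x} {y} x≤Sy with x ≟ S y
  ... | yes x≡Sy = inj₂ x≡Sy
  ... | no x≢Sy  = inj₁ (<S⇒≤ (x≤Sy , x≢Sy))

  <⇒S≤ : x < y → leq (S x) y
  <⇒S≤ {x} {y} (x≤y , x≢y) with B10 (S x) y
  ... | inj₁ Sx≤y = Sx≤y
  ... | inj₂ y≤Sx with ≤S⇒≤⊎≡S y≤Sx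
  ...   | inj₁ y≤x  = contradiction (B7 x y x≤y y≤x) x≢y
  ...   | inj₂ refl = ≤-refl y

  S-mono-≤ : leq x y → leq (S x) (S y)
  S-mono-≤ x≤y = <⇒S≤ (≤⇒<S x≤y)

  S-mono-< : x < y → S x < S y
  S-mono-< x<y = ≤⇒<S (<⇒S≤ x<y)

  S≤⇒< : leq (S x) y → x < y
  S≤⇒< {x} {y} Sx≤y with B10 x y | x ≟ y
  ... | _         | yes refl = ⊥-elim (Sx≰x Sx≤y)
  ... | inj₁ x≤y  | no x≢y   = x≤y , x≢y
  ... | inj₂ y≤x  | no x≢y   =
    contradiction (B2 x y (B7 (S x) (S y) (proj₁ (≤⇒<S Sx≤y)) (S-mono-≤ y≤x))) x≢y

  Prefix : Str → Num → Set
  Prefix X y = ∀ w → leq w y → mem w X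

  prefix-zero : mem z0 X → Prefix X z0
  prefix-zero {X} 0∈X w w≤0 = subst (λ v → mem v X) (sym (n≤0⇒n≡0 w≤0)) 0∈X

  prefix-suc : Prefix X y → mem (S y) X → Prefix X (S y)
  prefix-suc {X} [0,y]⊆X Sy∈X w w≤Sy with ≤S⇒≤⊎≡S w≤Sy
  ... | inj₁ w≤y  = [0,y]⊆X w w≤y
  ... | inj₂ refl = Sy∈X

  -- Y = {y ≤ b : [0, y] ⊆ X} contains 0, so by L1 and L2 its largest element is u = |Y| - 1;
  -- if u < b then u + 1 ∈ Y as well, which is impossible.
  string-induction : ∀ X b → mem z0 X → (∀ y → y < b → mem y X → mem (S y) X) → mem b X
  string-induction X b 0∈X step
    with COMP (`∀≤ (var zero) (var zero `∈ zero)) [] (X ∷ []) (S b)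
  ... | Y , |Y|≤Sb , Y-def = prefix-of-largest (B12 (len Y) |Y|≢0)
    where
    prefix∈Y : ∀ {y} → y < S b → Prefix X y → mem y Y
    prefix∈Y y<Sb = proj₂ (Y-def _ y<Sb)

    |Y|≢0 : len Y ≢ z0
    |Y|≢0 |Y|≡0 = n≮0 (subst (z0 <_) |Y|≡0 (L1 Y z0 (prefix∈Y (≤⇒<S (B9 b)) (prefix-zero 0∈X))))

    prefix-of-largest : (Σ Num λ u → leq u (len Y) × S u ≡ len Y) → mem b X
    prefix-of-largest (u , _ , Su≡|Y|) = decide (u ≟ b)
      where
      Su≤Sb : leq (S u) (S b)
      Su≤Sb = subst (λ v → leq v (S b)) (sym Su≡|Y|) |Y|≤Sb

      [0,u]⊆X : Prefix X u
      [0,u]⊆X = proj₁ (Y-def u (S≤⇒< Su≤Sb)) (L2 Y u Su≡|Y|)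

      decide : Dec (u ≡ b) → mem b X
      decide (yes refl) = [0,u]⊆X u (≤-refl u)
      decide (no u≢b)   = ⊥-elim (<-irrefl (subst (S u <_) (sym Su≡|Y|) (L1 Y (S u) Su∈Y)))
        where
        u<b : u < b
        u<b = <S⇒≤ (S≤⇒< Su≤Sb) , u≢b
        Su∈Y : mem (S u) Y
        Su∈Y = prefix∈Y (S-mono-< u<b) (prefix-suc [0,u]⊆X (step u u<b ([0,u]⊆X u (≤-refl u))))

  Σᴮ₀-IND : ∀ {n s} (φ : Fm (suc n) s) ρ σ →
    ⟦ φ ⟧f (extend ρ z0) σ → (∀ y → ⟦ φ ⟧f (extend ρ y) σ → ⟦ φ ⟧f (extend ρ (S y)) σ) →
    ∀ b → ⟦ φ ⟧f (extend ρ b) σ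
  Σᴮ₀-IND φ ρ σ base step b with COMP φ ρ σ (S b)
  ... | X , _ , X-def = proj₁ (X-def b (≤⇒<S (≤-refl b))) (string-induction X b 0∈X step-X)
    where
    0∈X : mem z0 X
    0∈X = proj₂ (X-def z0 (≤⇒<S (B9 b))) base

    step-X : ∀ y → y < b → mem y X → mem (S y) X
    step-X y y<b y∈X =
      proj₂ (X-def (S y) (S-mono-< y<b)) (step y (proj₁ (X-def y (≤⇒<S (proj₁ y<b))) y∈X))

  +-identityˡ : ∀ x → add z0 x ≡ x
  +-identityˡ = Σᴮ₀-IND ((`0 `+ var zero) `= var zero) [] [] (B3 z0)
    (λ y 0+y≡y → trans (B4 z0 y) (cong S 0+y≡y))

  ⌜_⌝ : ℕ → Num
  ⌜ zero ⌝  = z0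
  ⌜ suc a ⌝ = S ⌜ a ⌝

  ⌜⌝-injective : ∀ a b → ⌜ a ⌝ ≡ ⌜ b ⌝ → a ≡ b
  ⌜⌝-injective zero    zero    _ = refl
  ⌜⌝-injective zero    (suc b) e = ⊥-elim (B1 ⌜ b ⌝ (sym e))
  ⌜⌝-injective (suc a) zero    e = ⊥-elim (B1 ⌜ a ⌝ e)
  ⌜⌝-injective (suc a) (suc b) e = cong suc (⌜⌝-injective a b (B2 ⌜ a ⌝ ⌜ b ⌝ e))

  ⌜1⌝ : ⌜ 1 ⌝ ≡ z1
  ⌜1⌝ = +-identityˡ z1

  ⌜⌝-+ : ∀ a b → add ⌜ a ⌝ ⌜ b ⌝ ≡ ⌜ a ℕ.+ b ⌝
  ⌜⌝-+ a zero    = trans (B3 ⌜ a ⌝) (cong ⌜_⌝ (sym (+-identityʳ a)))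
  ⌜⌝-+ a (suc b) = trans (B4 ⌜ a ⌝ ⌜ b ⌝) (trans (cong S (⌜⌝-+ a b)) (cong ⌜_⌝ (sym (+-suc a b))))

  ⌜⌝-* : ∀ a b → mul ⌜ a ⌝ ⌜ b ⌝ ≡ ⌜ a ℕ.* b ⌝
  ⌜⌝-* a zero    = trans (B5 ⌜ a ⌝) (cong ⌜_⌝ (sym (*-zeroʳ a)))
  ⌜⌝-* a (suc b) = begin
    mul ⌜ a ⌝ (S ⌜ b ⌝)         ≡⟨ B6 ⌜ a ⌝ ⌜ b ⌝ ⟩
    add (mul ⌜ a ⌝ ⌜ b ⌝) ⌜ a ⌝ ≡⟨ cong (λ v → add v ⌜ a ⌝) (⌜⌝-* a b) ⟩
    add ⌜ a ℕ.* b ⌝ ⌜ a ⌝       ≡⟨ ⌜⌝-+ (a ℕ.* b) a ⟩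
    ⌜ a ℕ.* b ℕ.+ a ⌝           ≡⟨ cong ⌜_⌝ (trans (+-comm (a ℕ.* b) a) (sym (*-suc a b))) ⟩
    ⌜ a ℕ.* suc b ⌝             ∎
    where open ≡-Reasoning

  ⟦_⟧₀ : Tm 0 0 → Num
  ⟦ t ⟧₀ = ⟦ t ⟧t [] []

  closed-term-numeral : (t : Tm 0 0) → ⟦ t ⟧₀ ≡ ⌜ ⟦ t ⟧ℕ ⌝
  closed-term-numeral `0       = refl
  closed-term-numeral `1       = sym ⌜1⌝
  closed-term-numeral (t `+ u) =
    trans (cong₂ add (closed-term-numeral t) (closed-term-numeral u)) (⌜⌝-+ ⟦ t ⟧ℕ ⟦ u ⟧ℕ)
  closed-term-numeral (t `* u) =
    trans (cong₂ mul (closed-term-numeral t) (closed-term-numeral u)) (⌜⌝-* ⟦ t ⟧ℕ ⟦ u ⟧ℕ)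

  closed-terms-distinct : (t u : Tm 0 0) → ⟦ t ⟧ℕ ≢ ⟦ u ⟧ℕ → ⟦ t ⟧₀ ≢ ⟦ u ⟧₀
  closed-terms-distinct t u t≢u t≡u =
    t≢u (⌜⌝-injective _ _ (trans (sym (closed-term-numeral t)) (trans t≡u (closed-term-numeral u))))

  K₂-vertex : IsK2 VK EK → c < len VK → c ≡ z0 ⊎ c ≡ z1
  K₂-vertex {c = c} (|VK|≡2 , _) c<2 with c ≟ z1
  ... | yes c≡1 = inj₂ c≡1
  ... | no c≢1  = inj₁ (n≤0⇒n≡0 (<S⇒≤ c<⌜1⌝))
    where
    c<⌜1⌝ : c < S z0
    c<⌜1⌝ = subst (c <_) (sym ⌜1⌝) (<S⇒≤ (subst (c <_) |VK|≡2 c<2) , c≢1)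

  -- The loop codes ⟨0,0⟩ = 0 and ⟨1,1⟩ = 8 differ from the edge codes ⟨0,1⟩ = 4 and ⟨1,0⟩ = 2.
  K₂-loopless : IsK2 VK EK → c < len VK → ¬ Ed EK c c
  K₂-loopless K@(_ , _ , EK-def) c<2 loop with K₂-vertex K c<2 | proj₁ (EK-def _) loop
  ... | inj₁ refl | inj₁ e = closed-terms-distinct ⟨ `0 , `0 ⟩ᵗ ⟨ `0 , `1 ⟩ᵗ (λ ()) e
  ... | inj₁ refl | inj₂ e = closed-terms-distinct ⟨ `0 , `0 ⟩ᵗ ⟨ `1 , `0 ⟩ᵗ (λ ()) e
  ... | inj₂ refl | inj₁ e = closed-terms-distinct ⟨ `1 , `1 ⟩ᵗ ⟨ `0 , `1 ⟩ᵗ (λ ()) e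
  ... | inj₂ refl | inj₂ e = closed-terms-distinct ⟨ `1 , `1 ⟩ᵗ ⟨ `1 , `0 ⟩ᵗ (λ ()) e

  IsHom : Num → Str → Num → Str → Str → Set
  IsHom n EG m EH Z = MAP n m Z ×
    ((i₁ i₂ j₁ j₂ : Num) → i₁ < n → i₂ < n → j₁ < m → j₂ < m →
       Ed EG i₁ i₂ → mem (pair i₁ j₁) Z → mem (pair i₂ j₂) Z → Ed EH j₁ j₂)

  HOM⇒IsHom : HOM n EG m EH → Σ Str (IsHom n EG m EH)
  HOM⇒IsHom (_ , _ , _ , _ , Z , _ , Z-hom) = Z , Z-hom

  -- Nested so as to be definitionally the meaning of the ∃ j < m part of even-colour-Fm.
  Composite : Str → Num → Str → Num → Num → Set
  Composite Z₁ m Z₂ i c = Σ Num λ j → leq j m × j ≢ m × mem (pair i j) Z₁ × mem (pair j c) Z₂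

  composite-total : IsHom n EG m EH Z₁ → IsHom m EH l EK Z₂ →
    ∀ {i} → i < n → Σ Num λ c → c < l × Composite Z₁ m Z₂ i c
  composite-total ((total₁ , _) , _) ((total₂ , _) , _) i<n with total₁ _ i<n
  ... | j , j<m , ij∈Z₁ with total₂ j j<m
  ... | c , c<l , jc∈Z₂ = c , c<l , j , proj₁ j<m , proj₂ j<m , ij∈Z₁ , jc∈Z₂

  composite-preserves : IsHom n EG m EH Z₁ → IsHom m EH l EK Z₂ →
    i₁ < n → i₂ < n → c₁ < l → c₂ < l → Ed EG i₁ i₂ →
    Composite Z₁ m Z₂ i₁ c₁ → Composite Z₁ m Z₂ i₂ c₂ → Ed EK c₁ c₂
  composite-preserves (_ , preserves₁) (_ , preserves₂) i₁<n i₂<n c₁<l c₂<l i₁i₂∈EG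
    (j₁ , j₁≤m , j₁≢m , i₁j₁∈Z₁ , j₁c₁∈Z₂) (j₂ , j₂≤m , j₂≢m , i₂j₂∈Z₁ , j₂c₂∈Z₂) =
    preserves₂ j₁ j₂ _ _ (j₁≤m , j₁≢m) (j₂≤m , j₂≢m) c₁<l c₂<l
      (preserves₁ _ _ j₁ j₂ i₁<n i₂<n (j₁≤m , j₁≢m) (j₂≤m , j₂≢m) i₁i₂∈EG i₁j₁∈Z₁ i₂j₂∈Z₁)
      j₁c₁∈Z₂ j₂c₂∈Z₂

  record OddCycleHom (V E : Str) : Set where
    field
      half    : Num
      edges   : Str
      walk    : Str
      closing : Ed edges z0 (mul two half)
      path    : ∀ i → i < mul two half → Ed edges i (S i)
      hom     : IsHom (S (mul two half)) edges (len V) E walk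

  k<4k²⇒k≢0 : x < mul four (mul k k) → k ≢ z0
  k<4k²⇒k≢0 {x} x<4kk refl = n≮0 (subst (x <_) 4·0·0≡0 x<4kk)
    where
    4·0·0≡0 : mul four (mul z0 z0) ≡ z0
    4·0·0≡0 = trans (cong (mul four) (B5 z0)) (B5 four)

  IsPred⇒S : k ≢ z0 → IsPred k p → S p ≡ k
  IsPred⇒S _   (inj₁ Sp≡k)     = Sp≡k
  IsPred⇒S k≢0 (inj₂ (k≡0 , _)) = ⊥-elim (k≢0 k≡0)

  NONBIP⇒OddCycleHom : ∀ {V E} → NONBIP V E → OddCycleHom V E
  NONBIP⇒OddCycleHom (k , _ , (k₁ , k₁-pred , t , _ , refl) , _ , _ , EC , EC<4k² ,
                       (k₁′ , k₁′-pred , closing , path , _) , hom)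
    with IsPred⇒S (k<4k²⇒k≢0 EC<4k²) k₁-pred
  ... | refl with B2 k₁′ _ (IsPred⇒S (k<4k²⇒k≢0 EC<4k²) k₁′-pred)
  ... | refl = record
    { half = t ; edges = EC ; walk = proj₁ (HOM⇒IsHom hom)
    ; closing = closing ; path = path ; hom = proj₂ (HOM⇒IsHom hom) }

  double-suc : ∀ y → mul two (S y) ≡ S (S (mul two y))
  double-suc y = trans (B6 two y) (B4 (mul two y) z1)

  module _ {V E VK EK Z : Str} (K : IsK2 VK EK) (χ : IsHom (len V) E (len VK) EK Z)
           (C : OddCycleHom V E) where
    open OddCycleHom C

    Colour : Num → Num → Set
    Colour = Composite walk (len V) Z

    colour : leq x (mul two half) → Σ Num λ c → c < len VK × Colour x c
    colour x≤2h = composite-total hom χ (≤⇒<S x≤2h)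

    adjacent-colours-differ : x < mul two half → c₁ < len VK → c₂ < len VK →
      Colour x c₁ → Colour (S x) c₂ → c₁ ≢ c₂
    adjacent-colours-differ {x} x<2h c₁<2 c₂<2 x↦c₁ Sx↦c₂ refl =
      K₂-loopless K c₁<2 (composite-preserves hom χ (≤⇒<S (proj₁ x<2h)) (≤⇒<S (<⇒S≤ x<2h))
                                              c₁<2 c₂<2 (path x x<2h) x↦c₁ Sx↦c₂)

    colour-period-two : leq (S (S x)) (mul two half) → c < len VK → Colour x c → Colour (S (S x)) c
    colour-period-two {x} {c} SSx≤2h c<2 x↦c
      with colour (proj₁ (S≤⇒< SSx≤2h)) | colour SSx≤2h
    ... | c₁ , c₁<2 , Sx↦c₁ | c₂ , c₂<2 , SSx↦c₂ =
      subst (Colour (S (S x)))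
        (two-valued-alternation (K₂-vertex K c<2) (K₂-vertex K c₁<2) (K₂-vertex K c₂<2)
          (adjacent-colours-differ (S≤⇒< (proj₁ (S≤⇒< SSx≤2h))) c<2 c₁<2 x↦c Sx↦c₁)
          (adjacent-colours-differ (S≤⇒< SSx≤2h) c₁<2 c₂<2 Sx↦c₁ SSx↦c₂))
        SSx↦c₂

    -- 2t ≤ 2·half → ∃ j < |V| (⟨2t, j⟩ ∈ walk ∧ ⟨j, c⟩ ∈ Z), with number variables t, 2·half, c
    -- and string variables V, walk, Z.
    even-colour-Fm : Fm 3 3
    even-colour-Fm = (((`1 `+ `1) `* var zero) `≤ var (suc zero)) `⇒
      `∃≤ (`len zero) ((`¬ (var zero `= `len zero)) `∧
        ((⟨ (`1 `+ `1) `* var (suc zero) , var zero ⟩ᵗ `∈ suc zero) `∧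
         (⟨ var zero , var (suc (suc (suc zero))) ⟩ᵗ `∈ suc (suc zero))))

    even-vertices-coloured : c < len VK → Colour z0 c →
      ∀ t → leq (mul two t) (mul two half) → Colour (mul two t) c
    even-vertices-coloured {c} c<2 0↦c =
      Σᴮ₀-IND even-colour-Fm (mul two half ∷ c ∷ []) (V ∷ walk ∷ Z ∷ []) base step
      where
      base : leq (mul two z0) (mul two half) → Colour (mul two z0) c
      base _ = subst (λ v → Colour v c) (sym (B5 two)) 0↦c

      step : ∀ y → (leq (mul two y) (mul two half) → Colour (mul two y) c) →
             leq (mul two (S y)) (mul two half) → Colour (mul two (S y)) c
      step y ih 2Sy≤2h = subst (λ v → Colour v c) (sym (double-suc y))
        (colour-period-two SS2y≤2h c<2 (ih (proj₁ (S≤⇒< (proj₁ (S≤⇒< SS2y≤2h))))))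
        where
        SS2y≤2h : leq (S (S (mul two y))) (mul two half)
        SS2y≤2h = subst (λ v → leq v (mul two half)) (double-suc y) 2Sy≤2h

    odd-cycle-not-K₂-colourable : ⊥
    odd-cycle-not-K₂-colourable with colour (B9 (mul two half))
    ... | c , c<2 , 0↦c =
      K₂-loopless K c<2 (composite-preserves hom χ (≤⇒<S (B9 _)) (≤⇒<S (≤-refl _)) c<2 c<2 closing
                          0↦c (even-vertices-coloured c<2 0↦c half (≤-refl _)))

lemma5 : ExcludedMiddle 0ℓ → (M : Structure) → IsV0Model M →
    let open Structure M
        open Sem M
    in (V E : Str) → IsGraph V E → NONBIP V E →
       (VK EK : Str) → IsK2 VK EK → ¬ HOM (len V) E (len VK) EK
lemma5 em M model V E _ nonbip VK EK K hom =
  odd-cycle-not-K₂-colourable K (proj₂ (HOM⇒IsHom hom)) (NONBIP⇒OddCycleHom nonbip)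
  where open V⁰ em M model
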